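{- For any position $G$, there is no position $H$ such that $G > H$.
   Context: Positions are defined recursively: $*L$ and $*R$ are terminal positions; if $G_1,\dots,G_n$ ($n\ge 1$) are positions, then $\{G_1,\dots,G_n\}$ is a position with options $G_1,\dots,G_n$. All positions have finite game trees. Play: Left and Right move alternately, each choosing any option of the current position; when a terminal position is reached, Left wins if it is $*L$ and Right wins if it is $*R$. Disjunctive sum: $*L + *L = *R + *R = *L$, $*L + *R = *R + *L = *R$; if at least one of $G,H$ is non-terminal, $G+H$ has options all $G'+H$ ($G'$ an option of $G$) and all $G+H'$ ($H'$ an option of $H$). Outcome classes: $\mathcal{L}$ (Left wins moving first or second), $\mathcal{R}$ (Right wins moving first or second), $\mathcal{N}$ (first player wins), $\mathcal{P}$ (second player wins); $o(G)$ denotes the outcome class of $G$. Outcomes are partially ordered by $\mathcal{L} > \mathcal{P} > \mathcal{R}$, $\mathcal{L} > \mathcal{N} > \mathcal{R}$, with $\mathcal{P}$ and $\mathcal{N}$ incomparable. For positions $G,H$: $G \ge H$ iff $o(G+X) \ge o(H+X)$ for every position $X$; $G \le H$ iff $o(G+X) \le o(H+X)$ for every position $X$; $G > H$ iff $G \ge H$ and not $G \le H$. -}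

module Defs where

open import Data.Nat using (ℕ; zero; suc; _+_)
open import Data.Fin using (Fin; splitAt)
import Data.Fin as Fin
open import Data.Sum using ([_,_]′)
open import Data.Bool using (Bool; true; false; _∧_; _∨_)
open import Data.Product using (_×_)
open import Relation.Nullary using (¬_)

data Pos : Set where
  *L   : Pos
  *R   : Pos
  node : (k : ℕ) → (Fin (suc k) → Pos) → Pos

infixl 6 _⊕_
_⊕_ : Pos → Pos → Pos
*L ⊕ *L = *L
*L ⊕ *R = *R
*R ⊕ *L = *R
*R ⊕ *R = *L
node k f ⊕ *L = node k (λ i → f i ⊕ *L)
node k f ⊕ *R = node k (λ i → f i ⊕ *R)
*L ⊕ node m g = node m (λ j → *L ⊕ g j)
*R ⊕ node m g = node m (λ j → *R ⊕ g j)
node k f ⊕ node m g =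
  node (k + suc m)
    (λ x → [ (λ i → f i ⊕ node m g) , (λ j → node k f ⊕ g j) ]′ (splitAt (suc k) x))

anyFin : (n : ℕ) → (Fin n → Bool) → Bool
anyFin zero    p = false
anyFin (suc n) p = p Fin.zero ∨ anyFin n (λ i → p (Fin.suc i))

allFin : (n : ℕ) → (Fin n → Bool) → Bool
allFin zero    p = true
allFin (suc n) p = p Fin.zero ∧ allFin n (λ i → p (Fin.suc i))

-- leftWinsFirst G : Left wins G when Left moves first.
-- leftWinsSecond G : Left wins G when Right moves first.
-- At a terminal position no moves are made; Left wins iff it is *L.
leftWinsFirst  : Pos → Bool
leftWinsSecond : Pos → Bool
leftWinsFirst *L = true
leftWinsFirst *R = false
leftWinsFirst (node k f) = anyFin (suc k) (λ i → leftWinsSecond (f i))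
leftWinsSecond *L = true
leftWinsSecond *R = false
leftWinsSecond (node k f) = allFin (suc k) (λ i → leftWinsFirst (f i))

-- Outcome classes. Games are finite and determined, so Right wins moving
-- first iff Left does not win moving second, and symmetrically.
data Outcome : Set where
  𝓛 𝓝 𝓟 𝓡 : Outcome

outcomeOf : Bool → Bool → Outcome
outcomeOf true  true  = 𝓛
outcomeOf true  false = 𝓝
outcomeOf false true  = 𝓟
outcomeOf false false = 𝓡

o : Pos → Outcome
o G = outcomeOf (leftWinsFirst G) (leftWinsSecond G)

data _≤o_ : Outcome → Outcome → Set where
  refl≤ : ∀ {a} → a ≤o a
  𝓡≤𝓝 : 𝓡 ≤o 𝓝
  𝓡≤𝓟 : 𝓡 ≤o 𝓟
  𝓡≤𝓛 : 𝓡 ≤o 𝓛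
  𝓝≤𝓛 : 𝓝 ≤o 𝓛
  𝓟≤𝓛 : 𝓟 ≤o 𝓛

_≥G_ : Pos → Pos → Set
G ≥G H = ∀ X → o (H ⊕ X) ≤o o (G ⊕ X)

_≤G_ : Pos → Pos → Set
G ≤G H = ∀ X → o (G ⊕ X) ≤o o (H ⊕ X)

_>G_ : Pos → Pos → Set
G >G H = (G ≥G H) × ¬ (G ≤G H)

-- Exchanging the roles of *L and *R in X exchanges them in G + X, which
-- swaps the two players' winning sets and so reverses every outcome.  Hence
-- o(H + X') ≤ o(G + X') for the swapped position X' of X turns into
-- o(G + X) ≤ o(H + X): the inequality G ≥ H already forces G ≤ H.
module Submission where

open import Defs
open import Data.Bool using (Bool; true; false; not; _∧_; _∨_)
open import Data.Fin using (Fin; splitAt)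
import Data.Fin as Fin
open import Data.Nat using (zero; suc)
open import Data.Product using (∃; _×_; _,_; proj₁; proj₂)
open import Data.Sum using (_⊎_; inj₁; inj₂; [_,_]′)
open import Relation.Binary.PropositionalEquality using (_≡_; refl; sym; trans; cong₂; subst₂)
open import Relation.Nullary using (¬_)

swap : Pos → Pos
swap *L = *R
swap *R = *L
swap (node k f) = node k (λ i → swap (f i))

-- Stands in for B ≡ swap A, which would need function extensionality.
data Swapped : Pos → Pos → Set where
  *L↦*R : Swapped *L *R
  *R↦*L : Swapped *R *L
  node  : ∀ {k f g} → (∀ i → Swapped (f i) (g i)) → Swapped (node k f) (node k g)

not-∧ : ∀ a b → not (a ∧ b) ≡ not a ∨ not b
not-∧ true  b = refl
not-∧ false b = refl

not-∨ : ∀ a b → not (a ∨ b) ≡ not a ∧ not b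
not-∨ true  b = refl
not-∨ false b = refl

anyFin-not : ∀ n (p q : Fin n → Bool) → (∀ i → q i ≡ not (p i)) →
             anyFin n q ≡ not (allFin n p)
anyFin-not zero    p q q≡¬p = refl
anyFin-not (suc n) p q q≡¬p = trans
  (cong₂ _∨_ (q≡¬p Fin.zero) (anyFin-not n _ _ (λ i → q≡¬p (Fin.suc i))))
  (sym (not-∧ (p Fin.zero) _))

allFin-not : ∀ n (p q : Fin n → Bool) → (∀ i → q i ≡ not (p i)) →
             allFin n q ≡ not (anyFin n p)
allFin-not zero    p q q≡¬p = refl
allFin-not (suc n) p q q≡¬p = trans
  (cong₂ _∧_ (q≡¬p Fin.zero) (allFin-not n _ _ (λ i → q≡¬p (Fin.suc i))))
  (sym (not-∨ (p Fin.zero) _))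

leftWins-swapped : ∀ {A B} → Swapped A B →
  leftWinsFirst B ≡ not (leftWinsSecond A) × leftWinsSecond B ≡ not (leftWinsFirst A)
leftWins-swapped *L↦*R = refl , refl
leftWins-swapped *R↦*L = refl , refl
leftWins-swapped (node {k} A↦B) =
  anyFin-not (suc k) _ _ (λ i → proj₂ (leftWins-swapped (A↦B i))) ,
  allFin-not (suc k) _ _ (λ i → proj₁ (leftWins-swapped (A↦B i)))

reverse : Outcome → Outcome
reverse 𝓛 = 𝓡
reverse 𝓝 = 𝓝
reverse 𝓟 = 𝓟
reverse 𝓡 = 𝓛

outcomeOf-not : ∀ first second →
                outcomeOf (not second) (not first) ≡ reverse (outcomeOf first second)
outcomeOf-not true  true  = refl
outcomeOf-not true  false = refl
outcomeOf-not false true  = refl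
outcomeOf-not false false = refl

o-swapped : ∀ {A B} → Swapped A B → o B ≡ reverse (o A)
o-swapped {A} A↦B =
  trans (cong₂ outcomeOf (proj₁ (leftWins-swapped A↦B)) (proj₂ (leftWins-swapped A↦B)))
        (outcomeOf-not (leftWinsFirst A) (leftWinsSecond A))

reverse-antitone : ∀ {a b} → a ≤o b → reverse b ≤o reverse a
reverse-antitone refl≤ = refl≤
reverse-antitone 𝓡≤𝓝 = 𝓝≤𝓛
reverse-antitone 𝓡≤𝓟 = 𝓟≤𝓛
reverse-antitone 𝓡≤𝓛 = 𝓡≤𝓛
reverse-antitone 𝓝≤𝓛 = 𝓡≤𝓝
reverse-antitone 𝓟≤𝓛 = 𝓡≤𝓟

reverse-involutive : ∀ a → reverse (reverse a) ≡ a
reverse-involutive 𝓛 = refl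
reverse-involutive 𝓝 = refl
reverse-involutive 𝓟 = refl
reverse-involutive 𝓡 = refl

reverse-reflects-≤o : ∀ {a b} → reverse a ≤o reverse b → b ≤o a
reverse-reflects-≤o {a} {b} ra≤rb =
  subst₂ _≤o_ (reverse-involutive b) (reverse-involutive a) (reverse-antitone ra≤rb)

[,]-swapped : ∀ {A B : Set} {F F′ : A → Pos} {G G′ : B → Pos} (s : A ⊎ B) →
              (∀ i → Swapped (F i) (F′ i)) → (∀ j → Swapped (G j) (G′ j)) →
              Swapped ([ F , G ]′ s) ([ F′ , G′ ]′ s)
[,]-swapped (inj₁ i) F↦F′ G↦G′ = F↦F′ i
[,]-swapped (inj₂ j) F↦F′ G↦G′ = G↦G′ j

⊕-swapʳ : ∀ G X → Swapped (G ⊕ X) (G ⊕ swap X)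
⊕-swapʳ *L *L = *L↦*R
⊕-swapʳ *L *R = *R↦*L
⊕-swapʳ *R *L = *R↦*L
⊕-swapʳ *R *R = *L↦*R
⊕-swapʳ *L (node m g) = node (λ j → ⊕-swapʳ *L (g j))
⊕-swapʳ *R (node m g) = node (λ j → ⊕-swapʳ *R (g j))
⊕-swapʳ (node k f) *L = node (λ i → ⊕-swapʳ (f i) *L)
⊕-swapʳ (node k f) *R = node (λ i → ⊕-swapʳ (f i) *R)
⊕-swapʳ (node k f) (node m g) = node (λ x → [,]-swapped (splitAt (suc k) x)
  (λ i → ⊕-swapʳ (f i) (node m g)) (λ j → ⊕-swapʳ (node k f) (g j)))

o-⊕-swapʳ : ∀ G X → o (G ⊕ swap X) ≡ reverse (o (G ⊕ X))
o-⊕-swapʳ G X = o-swapped (⊕-swapʳ G X)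

≥G⇒≤G : ∀ G H → G ≥G H → G ≤G H
≥G⇒≤G G H G≥H X =
  reverse-reflects-≤o (subst₂ _≤o_ (o-⊕-swapʳ H X) (o-⊕-swapʳ G X) (G≥H (swap X)))

theorem2p19 : (G : Pos) → ¬ (∃ λ H → G >G H)
theorem2p19 G (H , G≥H , G≰H) = G≰H (≥G⇒≤G G H G≥H)
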